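{- Let $\lambda$ and $\mu$ be partitions (not necessarily with $\mu\subseteq\lambda$), let $\mathbf{b}=(b_1,b_2,\ldots)$ be the flagging induced by $\lambda/\mu$, and let $j>1$ be an integer with $\mu_{j-1}=\mu_j$. (a) If $m_j\notin\Delta(\lambda)$, then $b_j=b_{j-1}$. (b) If $m_j\in\Delta(\lambda)$, then $b_j=b_{j-1}+1$.
   Context: $m_i=\mu_i-i$; $\Delta(\lambda)=\{\lambda_i-i:i\ge1\}$. The flagging induced by $\lambda/\mu$ is $b_i=\max\{k\ge0:\lambda_k-k\ge\mu_i-i\}$ with the convention $\lambda_0=+\infty$. -}

module Defs where

open import Data.Nat using (ℕ; zero; suc; _≥_; _≤_; _<_)
open import Data.Integer using (ℤ; +_; _-_) renaming (_≤_ to _≤ℤ_; _<_ to _<ℤ_)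
open import Data.List using (List; []; _∷_)
open import Data.List.Relation.Unary.Linked using (Linked)
open import Data.Product using (Σ; _×_)
open import Data.Sum using (_⊎_)
open import Relation.Binary.PropositionalEquality using (_≡_)

-- A partition is a weakly decreasing finite list of natural numbers
-- (trailing zeros allowed; parts beyond the list are 0).
IsPartition : List ℕ → Set
IsPartition = Linked _≥_

-- λ ⟦ i ⟧ is the i-th part λ_i, 1-indexed, 0 beyond the length.
-- (index 0 is never used as a part: the convention λ_0 = +∞ is built
--  into the flagging definition below.)
_⟦_⟧ : List ℕ → ℕ → ℕ
[]      ⟦ _ ⟧           = 0
(x ∷ l) ⟦ zero ⟧        = 0
(x ∷ l) ⟦ suc zero ⟧    = x
(x ∷ l) ⟦ suc (suc i) ⟧ = l ⟦ suc i ⟧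

diag : List ℕ → ℕ → ℤ
diag l i = + (l ⟦ i ⟧) - + i

m : List ℕ → ℕ → ℤ
m = diag

_∈Δ_ : ℤ → List ℕ → Set
z ∈Δ l = Σ ℕ (λ i → (1 ≤ i) × (diag l i ≡ z))

-- "k belongs to {k ≥ 0 : λ_k - k ≥ t}" with the convention λ_0 = +∞
InFlagSet : List ℕ → ℤ → ℕ → Set
InFlagSet l t zero    = Data.Unit.⊤
  where import Data.Unit
InFlagSet l t (suc k) = t ≤ℤ diag l (suc k)

IsFlagEntry : List ℕ → List ℕ → ℕ → ℕ → Set
IsFlagEntry lam mu i b =
  InFlagSet lam (m mu i) b × (∀ k → InFlagSet lam (m mu i) k → k ≤ b)

IsInducedFlagging : List ℕ → List ℕ → (ℕ → ℕ) → Set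
IsInducedFlagging lam mu b = ∀ i → 1 ≤ i → IsFlagEntry lam mu i (b i)

{-# OPTIONS --safe #-}
module Submission where

open import Defs
open import Data.Nat using (ℕ; zero; suc; _≤_; _<_; z≤n; s≤s; s≤s⁻¹)
import Data.Nat.Properties as ℕ
open import Data.Integer using (ℤ; +_; -_; _-_; +≤+; pred)
  renaming (_≤_ to _≤ℤ_; _<_ to _<ℤ_)
import Data.Integer.Properties as ℤ
open import Data.List using (List; []; _∷_)
open import Data.List.Relation.Unary.Linked using (_∷_)
open import Data.Product using (_×_; _,_; proj₁)
open import Data.Sum using (inj₁; inj₂)
open import Data.Unit using (tt)
open import Relation.Nullary using (¬_)
open import Relation.Binary.PropositionalEquality using (_≡_; refl; sym; subst)

-- Since λ_k - k is strictly decreasing in k ≥ 1, the flag set for t is an initial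
-- segment {0, …, b} with b = max{k : λ_k - k ≥ t}. Passing from t = m_{j-1} to
-- m_j = t - 1 can only add the index b + 1, and it does exactly when
-- λ_{b+1} - (b+1) = t - 1, i.e. exactly when m_j ∈ Δ(λ).

part-antitone-suc : ∀ {l} → IsPartition l → ∀ k → l ⟦ suc (suc k) ⟧ ≤ l ⟦ suc k ⟧
part-antitone-suc {[]}        _            _       = z≤n
part-antitone-suc {x ∷ []}    _            _       = z≤n
part-antitone-suc {x ∷ y ∷ l} (x≥y ∷ _)    zero    = x≥y
part-antitone-suc {x ∷ y ∷ l} (_ ∷ l-part) (suc k) = part-antitone-suc l-part k

diag-suc : ∀ l k → diag l (suc k) ≡ pred (+ (l ⟦ suc k ⟧) - + k)
diag-suc l k = ℤ.minus-suc (+ (l ⟦ suc k ⟧)) k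

module _ {l : List ℕ} (l-part : IsPartition l) where

  diag-step : ∀ k → diag l (suc (suc k)) <ℤ diag l (suc k)
  diag-step k = ℤ.<-≤-trans
    (ℤ.i≤pred[j]⇒i<j (ℤ.≤-reflexive (diag-suc l (suc k))))
    (ℤ.+-monoˡ-≤ (- + suc k) (+≤+ (part-antitone-suc l-part k)))

  diag-antitone : ∀ {k k′} → k ≤ k′ → diag l (suc k′) ≤ℤ diag l (suc k)
  diag-antitone k≤k′ with ℕ.m≤n⇒m<n∨m≡n k≤k′
  ... | inj₂ refl        = ℤ.≤-refl
  ... | inj₁ (s≤s k≤k″) = ℤ.≤-trans (ℤ.<⇒≤ (diag-step _)) (diag-antitone k≤k″)

  diag-strictlyAntitone : ∀ {k k′} → k < k′ → diag l (suc k′) <ℤ diag l (suc k)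
  diag-strictlyAntitone k<k′ = ℤ.≤-<-trans (diag-antitone k<k′) (diag-step _)

  inFlagSet-downward : ∀ {t k k′} → k ≤ k′ → InFlagSet l t k′ → InFlagSet l t k
  inFlagSet-downward {k = zero}  _         _       = tt
  inFlagSet-downward {k = suc k} (s≤s k≤k′) t≤diag = ℤ.≤-trans t≤diag (diag-antitone k≤k′)

inFlagSet-weaken : ∀ {l t t′} k → t′ ≤ℤ t → InFlagSet l t k → InFlagSet l t′ k
inFlagSet-weaken zero    _    _      = tt
inFlagSet-weaken (suc k) t′≤t t≤diag = ℤ.≤-trans t′≤t t≤diag

IsFlagMax : List ℕ → ℤ → ℕ → Set
IsFlagMax l t b = InFlagSet l t b × (∀ k → InFlagSet l t k → k ≤ b)

flagMax-unique : ∀ {l t b b′} → IsFlagMax l t b → IsFlagMax l t b′ → b ≡ b′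
flagMax-unique (b∈ , b-max) (b′∈ , b′-max) = ℕ.≤-antisym (b′-max _ b∈) (b-max _ b′∈)

flagMax-next< : ∀ {l t b} → IsFlagMax l t b → diag l (suc b) <ℤ t
flagMax-next< (_ , b-max) = ℤ.≰⇒> λ t≤diag → ℕ.<-irrefl refl (b-max _ t≤diag)

flagMax-intro : ∀ {l t b} → IsPartition l →
  InFlagSet l t b → diag l (suc b) <ℤ t → IsFlagMax l t b
flagMax-intro {b = b} l-part b∈ next<t = b∈ , b-max
  where
    b-max : ∀ k → InFlagSet _ _ k → k ≤ b
    b-max k k∈ = ℕ.≮⇒≥ λ b<k →
      ℤ.<⇒≱ next<t (inFlagSet-downward l-part {k = suc b} b<k k∈)

module _ {l : List ℕ} (l-part : IsPartition l) {t : ℤ} {b : ℕ}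
         (b-max : IsFlagMax l t b) where

  private
    pred<t : pred t <ℤ t
    pred<t = ℤ.i≤pred[j]⇒i<j ℤ.≤-refl

    next≤pred : diag l (suc b) ≤ℤ pred t
    next≤pred = ℤ.i<j⇒i≤pred[j] (flagMax-next< b-max)

  Δ-index-pred : ∀ i → diag l (suc i) ≡ pred t → i ≡ b
  Δ-index-pred i diag≡pred = ℕ.≤-antisym i≤b b≤i
    where
      i≤b : i ≤ b
      i≤b = ℕ.≮⇒≥ λ b<i → ℤ.<⇒≱ (diag-strictlyAntitone l-part b<i)
        (subst (diag l (suc b) ≤ℤ_) (sym diag≡pred) next≤pred)
      b≤i : b ≤ i
      b≤i = ℕ.≮⇒≥ λ i<b → ℤ.<⇒≱ pred<t
        (subst (t ≤ℤ_) diag≡pred (inFlagSet-downward l-part i<b (proj₁ b-max)))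

  flagMax-pred-∉Δ : ¬ (pred t ∈Δ l) → IsFlagMax l (pred t) b
  flagMax-pred-∉Δ pred∉Δ = flagMax-intro l-part
    (inFlagSet-weaken b (ℤ.<⇒≤ pred<t) (proj₁ b-max))
    (ℤ.≤∧≢⇒< next≤pred λ next≡pred → pred∉Δ (suc b , s≤s z≤n , next≡pred))

  flagMax-pred-∈Δ : pred t ∈Δ l → IsFlagMax l (pred t) (suc b)
  flagMax-pred-∈Δ (suc i , _ , diag≡pred) with Δ-index-pred i diag≡pred
  ... | refl = flagMax-intro l-part
    (ℤ.≤-reflexive (sym diag≡pred))
    (subst (_ <ℤ_) diag≡pred (diag-step l-part b))

m-suc-of-equal-parts : ∀ mu j → mu ⟦ j ⟧ ≡ mu ⟦ suc j ⟧ → m mu (suc j) ≡ pred (m mu j)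
m-suc-of-equal-parts mu j μ-eq rewrite μ-eq = diag-suc mu j

-- Only λ needs to be a partition.
lemma10p14 : (lam mu : List ℕ) → IsPartition lam → IsPartition mu →
    (b : ℕ → ℕ) → IsInducedFlagging lam mu b →
    (j : ℕ) → 1 < suc j → mu ⟦ j ⟧ ≡ mu ⟦ suc j ⟧ →
    ((¬ (m mu (suc j) ∈Δ lam)) → b (suc j) ≡ b j)
    × ((m mu (suc j) ∈Δ lam) → b (suc j) ≡ suc (b j))
lemma10p14 lam mu lam-part _ b b-flag j 1<1+j μ-eq rewrite m-suc-of-equal-parts mu j μ-eq =
    (λ ∉Δ → flagMax-unique b₊-max (flagMax-pred-∉Δ lam-part b-max ∉Δ))
  , (λ ∈Δ → flagMax-unique b₊-max (flagMax-pred-∈Δ lam-part b-max ∈Δ))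
  where
    b-max : IsFlagMax lam (m mu j) (b j)
    b-max = b-flag j (s≤s⁻¹ 1<1+j)
    b₊-max : IsFlagMax lam (pred (m mu j)) (b (suc j))
    b₊-max = subst (λ t → IsFlagMax lam t (b (suc j)))
      (m-suc-of-equal-parts mu j μ-eq) (b-flag (suc j) (s≤s z≤n))
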